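{- Let $G$ be a connected graph. Then the following statements are equivalent: (A1) $G$ is $\{P_4, C_4, \text{paw}, \text{diamond}\}$-free; (A5) every graph search ordering of $G$ is a LexDFS ordering of $G$; (A6) every graph search ordering of $G$ is a LexBFS ordering of $G$.
   Context: All graphs are finite and simple. For an ordering $\sigma$ of $V(G)$ write $x<_\sigma y$ if $x$ precedes $y$. A graph search ordering of $G$ is an ordering of $V(G)$ such that every prefix induces a connected subgraph. In each of the following, the condition is required for all $a<_\sigma b<_\sigma c$ with $ac\in E(G)$ and $ab\notin E(G)$: $\sigma$ is a LexBFS ordering if there is $d$ with $d<_\sigma a$, $db\in E(G)$, $dc\notin E(G)$; a LexDFS ordering if there is $d$ with $a<_\sigma d<_\sigma b$, $db\in E(G)$, $dc\notin E(G)$. The paw is a triangle plus one extra vertex adjacent to exactly one triangle vertex; the diamond is $K_4$ minus one edge. $\mathcal{F}$-free means no induced subgraph isomorphic to a member of $\mathcal{F}$. -}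

module Defs where

open import Data.Nat using (ℕ; suc)
open import Data.Fin using (Fin; zero; suc; _<_)
open import Data.Bool using (Bool; true; false; T)
open import Data.Product using (Σ; ∃; ∃-syntax; _×_; _,_)
open import Data.List using (List)
open import Data.Empty using (⊥)
open import Data.Unit using (⊤)
open import Relation.Nullary using (¬_)
open import Relation.Binary.PropositionalEquality using (_≡_)
open import Function.Definitions using (Injective)
open import Function.Bundles using (_⇔_)

record Graph : Set where
  field
    n     : ℕ
    adj   : Fin n → Fin n → Bool
    sym   : ∀ x y → adj x y ≡ adj y x
    irr   : ∀ x → adj x x ≡ false

open Graph public

Vertex : Graph → Set
Vertex G = Fin (n G)

E : (G : Graph) → Vertex G → Vertex G → Set
E G x y = T (adj G x y)

data WalkIn (G : Graph) (S : Vertex G → Set) : Vertex G → Vertex G → Set where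
  here : ∀ {x} → S x → WalkIn G S x x
  step : ∀ {x y z} → S x → E G x y → WalkIn G S y z → WalkIn G S x z

-- the subgraph induced by S is connected (empty set counts as connected)
InducedConnected : (G : Graph) → (Vertex G → Set) → Set
InducedConnected G S = ∀ u v → S u → S v → WalkIn G S u v

Connected : Graph → Set
Connected G = InducedConnected G (λ _ → ⊤)

-- An ordering of V(G): an injective (hence bijective) position map
-- V(G) → {0,…,n-1}; x precedes y iff pos x < pos y.
record Ordering (G : Graph) : Set where
  field
    pos    : Vertex G → Fin (n G)
    pos-inj : Injective _≡_ _≡_ pos

open Ordering public

_≺[_]_ : {G : Graph} → Vertex G → Ordering G → Vertex G → Set
x ≺[ σ ] y = pos σ x < pos σ y

IsSearchOrdering : (G : Graph) → Ordering G → Set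
IsSearchOrdering G σ =
  ∀ (k : Vertex G) → InducedConnected G (λ x → ¬ (k ≺[ σ ] x))
-- note: the prefixes {x | pos x ≤ pos k} for k ∈ V(G) are exactly all
-- nonempty prefixes; the empty prefix is trivially connected.

IsLexBFS : (G : Graph) → Ordering G → Set
IsLexBFS G σ =
  ∀ a b c → a ≺[ σ ] b → b ≺[ σ ] c → E G a c → ¬ E G a b →
  ∃[ d ] (d ≺[ σ ] a × E G d b × ¬ E G d c)

IsLexDFS : (G : Graph) → Ordering G → Set
IsLexDFS G σ =
  ∀ a b c → a ≺[ σ ] b → b ≺[ σ ] c → E G a c → ¬ E G a b →
  ∃[ d ] (a ≺[ σ ] d × d ≺[ σ ] b × E G d b × ¬ E G d c)

InducedSub : Graph → Graph → Set
InducedSub H G =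
  Σ (Vertex H → Vertex G) λ f →
    Injective _≡_ _≡_ f × (∀ i j → adj H i j ≡ adj G (f i) (f j))

private
  F4 = Fin 4
  v0 v1 v2 v3 : F4
  v0 = zero
  v1 = suc zero
  v2 = suc (suc zero)
  v3 = suc (suc (suc zero))

p4adj : Fin 4 → Fin 4 → Bool
p4adj zero (suc zero) = true
p4adj (suc zero) zero = true
p4adj (suc zero) (suc (suc zero)) = true
p4adj (suc (suc zero)) (suc zero) = true
p4adj (suc (suc zero)) (suc (suc (suc zero))) = true
p4adj (suc (suc (suc zero))) (suc (suc zero)) = true
p4adj _ _ = false

c4adj : Fin 4 → Fin 4 → Bool
c4adj zero (suc zero) = true
c4adj (suc zero) zero = true
c4adj (suc zero) (suc (suc zero)) = true
c4adj (suc (suc zero)) (suc zero) = true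
c4adj (suc (suc zero)) (suc (suc (suc zero))) = true
c4adj (suc (suc (suc zero))) (suc (suc zero)) = true
c4adj (suc (suc (suc zero))) zero = true
c4adj zero (suc (suc (suc zero))) = true
c4adj _ _ = false

-- paw : triangle 0,1,2 plus 3 adjacent to 0
pawadj : Fin 4 → Fin 4 → Bool
pawadj zero (suc zero) = true
pawadj (suc zero) zero = true
pawadj zero (suc (suc zero)) = true
pawadj (suc (suc zero)) zero = true
pawadj (suc zero) (suc (suc zero)) = true
pawadj (suc (suc zero)) (suc zero) = true
pawadj zero (suc (suc (suc zero))) = true
pawadj (suc (suc (suc zero))) zero = true
pawadj _ _ = false

-- diamond : K4 minus the edge 2-3
diamadj : Fin 4 → Fin 4 → Bool
diamadj (suc (suc zero)) (suc (suc (suc zero))) = false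
diamadj (suc (suc (suc zero))) (suc (suc zero)) = false
diamadj zero zero = false
diamadj (suc zero) (suc zero) = false
diamadj (suc (suc zero)) (suc (suc zero)) = false
diamadj (suc (suc (suc zero))) (suc (suc (suc zero))) = false
diamadj _ _ = true

private
  fins : ∀ {P : Fin 4 → Set} → P v0 → P v1 → P v2 → P v3 → ∀ x → P x
  fins a b c d zero = a
  fins a b c d (suc zero) = b
  fins a b c d (suc (suc zero)) = c
  fins a b c d (suc (suc (suc zero))) = d

open import Relation.Binary.PropositionalEquality using (refl)

P4 : Graph
P4 = record { n = 4 ; adj = p4adj
  ; sym = fins (fins refl refl refl refl) (fins refl refl refl refl)
               (fins refl refl refl refl) (fins refl refl refl refl)
  ; irr = fins refl refl refl refl }

C4 : Graph
C4 = record { n = 4 ; adj = c4adj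
  ; sym = fins (fins refl refl refl refl) (fins refl refl refl refl)
               (fins refl refl refl refl) (fins refl refl refl refl)
  ; irr = fins refl refl refl refl }

Paw : Graph
Paw = record { n = 4 ; adj = pawadj
  ; sym = fins (fins refl refl refl refl) (fins refl refl refl refl)
               (fins refl refl refl refl) (fins refl refl refl refl)
  ; irr = fins refl refl refl refl }

Diamond : Graph
Diamond = record { n = 4 ; adj = diamadj
  ; sym = fins (fins refl refl refl refl) (fins refl refl refl refl)
               (fins refl refl refl refl) (fins refl refl refl refl)
  ; irr = fins refl refl refl refl }

FreeOf : List Graph → Graph → Set
FreeOf Fs G = ∀ {H} → H ∈ Fs → ¬ InducedSub H G
  where open import Data.List.Membership.Propositional using (_∈_)

P4C4PawDiamondFree : Graph → Set
P4C4PawDiamondFree = FreeOf (P4 List.∷ C4 List.∷ Paw List.∷ Diamond List.∷ List.[])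
  where import Data.List as List

{-# OPTIONS --safe #-}

-- A graph avoids P4, C4, the paw and the diamond iff it has no path y–u–v–w with u ≁ w.
-- In a search ordering of such a graph, a ≺ b ≺ c with ac an edge forces ab to be an edge:
-- the prefix ending at b joins a to b, walking along it yields some x ≼ b adjacent to both,
-- and if a ≁ b then c–a–x–b is a forbidden path.  So the LexBFS and LexDFS conditions hold
-- vacuously.  Conversely, any connected prefix of a connected graph extends greedily to a
-- search ordering, so a forbidden path y–u–v–w gives search orderings beginning u v w y and
-- v u w y; in both, u ≺ w ≺ y with uy an edge and uw not, and there is no vertex before u,
-- resp. between u and w, to serve as the required d.
module Submission where

open import Defs
open import Data.Nat as ℕ using (ℕ; zero; suc; _+_; _∸_; z<s; s<s)
import Data.Nat.Properties as ℕₚ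
open import Data.Nat.Induction using (<-wellFounded)
open import Induction.WellFounded using (Acc; acc)
open import Data.Fin using (Fin; toℕ; fromℕ<)
open import Data.Fin.Patterns using (0F; 1F; 2F; 3F)
import Data.Fin.Properties as Finₚ
open import Data.Bool using (Bool; true; false; T)
open import Data.Bool.Properties using (T-≡)
open import Data.Vec.Functional using ([]; _∷_)
open import Data.Product using (Σ; ∃-syntax; _×_; _,_; proj₁; proj₂)
open import Data.Sum using (_⊎_; inj₁; inj₂)
open import Data.Empty using (⊥; ⊥-elim)
open import Data.Unit using (tt)
open import Data.List.Relation.Unary.Any using (here; there)
open import Relation.Nullary using (¬_; Dec; yes; no)
open import Relation.Nullary.Decidable using (T?; decidable-stable)
open import Relation.Unary using (Decidable)
open import Relation.Binary.PropositionalEquality as ≡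
  using (_≡_; _≢_; refl; subst; subst₂; cong; ≢-sym)
open import Function.Definitions using (Injective)
open import Function.Bundles using (_⇔_; mk⇔; Equivalence)

module Edges (G : Graph) where

  E-sym : ∀ {x y} → E G x y → E G y x
  E-sym {x} {y} = subst T (Graph.sym G x y)

  E⇒≢ : ∀ {x y} → E G x y → x ≢ y
  E⇒≢ {x} xx refl = subst T (Graph.irr G x) xx

module _ {G : Graph} where
  open Edges G

  module _ {S : Vertex G → Set} where

    walk-start : ∀ {x y} → WalkIn G S x y → S x
    walk-start (here sx)     = sx
    walk-start (step sx _ _) = sx

    _++ʷ_ : ∀ {x y z} → WalkIn G S x y → WalkIn G S y z → WalkIn G S x z
    here _        ++ʷ q = q
    step sx xx' p ++ʷ q = step sx xx' (p ++ʷ q)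

    reverseʷ : ∀ {x y} → WalkIn G S x y → WalkIn G S y x
    reverseʷ (here sx)       = here sx
    reverseʷ (step sx xx' p) = reverseʷ p ++ʷ step (walk-start p) (E-sym xx') (here sx)

    walk-exits : ∀ {Q : Vertex G → Set} → Decidable Q → ∀ {x z} → WalkIn G S x z →
                 Q x → ¬ Q z → ∃[ y ] ∃[ y' ] Q y × ¬ Q y' × E G y y'
    walk-exits Q? (here _) qx ¬qz = ⊥-elim (¬qz qx)
    walk-exits Q? (step {x} {x'} _ xx' p) qx ¬qz with Q? x'
    ... | yes qx' = walk-exits Q? p qx' ¬qz
    ... | no ¬qx' = x , x' , qx , ¬qx' , xx'

  mapʷ : ∀ {S S' : Vertex G → Set} → (∀ {x} → S x → S' x) →
         ∀ {x y} → WalkIn G S x y → WalkIn G S' x y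
  mapʷ f (here sx)       = here (f sx)
  mapʷ f (step sx xx' p) = step (f sx) xx' (mapʷ f p)

-- The path y–u–v–w with u ≁ w induces P4, C4, the paw or the diamond, according to
-- which of the chords yv, yw are present.
record Quad (G : Graph) (y u v w : Vertex G) : Set where
  field
    yu  : E G y u
    uv  : E G u v
    vw  : E G v w
    u≁w : ¬ E G u w
    u≢w : u ≢ w
    y≢v : y ≢ v
    y≢w : y ≢ w

QuadFree : Graph → Set
QuadFree G = ∀ {y u v w} → ¬ Quad G y u v w

Quad-map : ∀ {H G} {f : Vertex H → Vertex G} → Injective _≡_ _≡_ f →
           (∀ i j → adj H i j ≡ adj G (f i) (f j)) →
           ∀ {y u v w} → Quad H y u v w → Quad G (f y) (f u) (f v) (f w)
Quad-map {H} {G} {f} f-inj f-adj q = record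
  { yu  = edge yu ; uv = edge uv ; vw = edge vw
  ; u≁w = λ e → u≁w (subst T (≡.sym (f-adj _ _)) e)
  ; u≢w = λ e → u≢w (f-inj e)
  ; y≢v = λ e → y≢v (f-inj e)
  ; y≢w = λ e → y≢w (f-inj e) }
  where
  open Quad q
  edge : ∀ {i j} → E H i j → E G (f i) (f j)
  edge {i} {j} = subst T (f-adj i j)

P4-quad : Quad P4 0F 1F 2F 3F
P4-quad = record { yu = tt ; uv = tt ; vw = tt ; u≁w = λ () ; u≢w = λ () ; y≢v = λ () ; y≢w = λ () }

C4-quad : Quad C4 0F 1F 2F 3F
C4-quad = record { yu = tt ; uv = tt ; vw = tt ; u≁w = λ () ; u≢w = λ () ; y≢v = λ () ; y≢w = λ () }

Paw-quad : Quad Paw 2F 1F 0F 3F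
Paw-quad = record { yu = tt ; uv = tt ; vw = tt ; u≁w = λ () ; u≢w = λ () ; y≢v = λ () ; y≢w = λ () }

Diamond-quad : Quad Diamond 1F 2F 0F 3F
Diamond-quad = record { yu = tt ; uv = tt ; vw = tt ; u≁w = λ () ; u≢w = λ () ; y≢v = λ () ; y≢w = λ () }

quadFree⇒free : ∀ {G} → QuadFree G → P4C4PawDiamondFree G
quadFree⇒free qf (here refl)                         (_ , f-inj , f-adj) = qf (Quad-map f-inj f-adj P4-quad)
quadFree⇒free qf (there (here refl))                 (_ , f-inj , f-adj) = qf (Quad-map f-inj f-adj C4-quad)
quadFree⇒free qf (there (there (here refl)))         (_ , f-inj , f-adj) = qf (Quad-map f-inj f-adj Paw-quad)
quadFree⇒free qf (there (there (there (here refl)))) (_ , f-inj , f-adj) = qf (Quad-map f-inj f-adj Diamond-quad)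

Pairs4 : (Fin 4 → Fin 4 → Set) → Set
Pairs4 R = R 0F 1F × R 0F 2F × R 0F 3F × R 1F 2F × R 1F 3F × R 2F 3F

Pairs4-map : ∀ {R R'} → (∀ {i j} → R i j → R' i j) → Pairs4 R → Pairs4 R'
Pairs4-map f (r01 , r02 , r03 , r12 , r13 , r23) = f r01 , f r02 , f r03 , f r12 , f r13 , f r23

Pairs4-all : ∀ {R} → (∀ i → R i i) → (∀ {i j} → R i j → R j i) → Pairs4 R → ∀ i j → R i j
Pairs4-all {R} diag flip (r01 , r02 , r03 , r12 , r13 , r23) = all
  where
  all : ∀ i j → R i j
  all 0F 0F = diag 0F
  all 0F 1F = r01
  all 0F 2F = r02
  all 0F 3F = r03
  all 1F 0F = flip r01
  all 1F 1F = diag 1F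
  all 1F 2F = r12
  all 1F 3F = r13
  all 2F 0F = flip r02
  all 2F 1F = flip r12
  all 2F 2F = diag 2F
  all 2F 3F = r23
  all 3F 0F = flip r03
  all 3F 1F = flip r13
  all 3F 2F = flip r23
  all 3F 3F = diag 3F

Distinct4 : ∀ {A : Set} → (Fin 4 → A) → Set
Distinct4 x = Pairs4 (λ i j → x i ≢ x j)

induced4 : ∀ {G} (h : Fin 4 → Fin 4 → Bool) → (∀ i j → h i j ≡ h j i) → (∀ i → h i i ≡ false) →
           (x : Fin 4 → Vertex G) → Distinct4 x → Pairs4 (λ i j → h i j ≡ adj G (x i) (x j)) →
           Σ (Fin 4 → Vertex G) λ f → Injective _≡_ _≡_ f × (∀ i j → h i j ≡ adj G (f i) (f j))
induced4 {G} h h-sym h-irr x distinct agree = x , injective , Pairs4-all diag flip agree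
  where
  separated : Pairs4 (λ i j → x i ≡ x j → i ≡ j)
  separated = Pairs4-map {R = λ i j → x i ≢ x j} {R' = λ i j → x i ≡ x j → i ≡ j}
                         (λ x≢ e → ⊥-elim (x≢ e)) distinct
  injective : Injective _≡_ _≡_ x
  injective {i} {j} = Pairs4-all (λ _ _ → refl) (λ sep e → ≡.sym (sep (≡.sym e))) separated i j
  diag : ∀ i → h i i ≡ adj G (x i) (x i)
  diag i = ≡.trans (h-irr i) (≡.sym (Graph.irr G (x i)))
  flip : ∀ {i j} → h i j ≡ adj G (x i) (x j) → h j i ≡ adj G (x j) (x i)
  flip {i} {j} e = ≡.trans (h-sym j i) (≡.trans e (Graph.sym G (x i) (x j)))

module _ {G : Graph} where
  open Edges G

  private
    true≡ : ∀ {x y} → E G x y → true ≡ adj G x y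
    true≡ e = ≡.sym (Equivalence.to T-≡ e)

    false≡ : ∀ {x y} → ¬ E G x y → false ≡ adj G x y
    false≡ {x} {y} ¬e with adj G x y
    ... | false = refl
    ... | true  = ⊥-elim (¬e tt)

  free⇒quadFree : P4C4PawDiamondFree G → QuadFree G
  free⇒quadFree free {y} {u} {v} {w} q = embed (adj G y v) (adj G y w) refl refl
    where
    open Quad q
    path fan : Fin 4 → Vertex G
    path = y ∷ u ∷ v ∷ w ∷ []
    fan  = v ∷ y ∷ u ∷ w ∷ []
    path-distinct : Distinct4 path
    path-distinct = E⇒≢ yu , y≢v , y≢w , E⇒≢ uv , u≢w , E⇒≢ vw
    fan-distinct : Distinct4 fan
    fan-distinct = ≢-sym y≢v , ≢-sym (E⇒≢ uv) , E⇒≢ vw , E⇒≢ yu , y≢w , u≢w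
    path-agrees : ∀ {b c} → b ≡ adj G y v → c ≡ adj G y w →
                  true ≡ adj G y u × b ≡ adj G y v × c ≡ adj G y w ×
                  true ≡ adj G u v × false ≡ adj G u w × true ≡ adj G v w
    path-agrees yv yw = true≡ yu , yv , yw , true≡ uv , false≡ u≁w , true≡ vw
    fan-agrees : ∀ {c} → true ≡ adj G y v → c ≡ adj G y w →
                 true ≡ adj G v y × true ≡ adj G v u × true ≡ adj G v w ×
                 true ≡ adj G y u × c ≡ adj G y w × false ≡ adj G u w
    fan-agrees yv yw =
      ≡.trans yv (Graph.sym G y v) , true≡ (E-sym uv) , true≡ vw , true≡ yu , yw , false≡ u≁w
    embed : ∀ b c → b ≡ adj G y v → c ≡ adj G y w → ⊥
    embed false false yv yw = free (here refl)
      (induced4 {G} (adj P4) (Graph.sym P4) (Graph.irr P4) path path-distinct (path-agrees yv yw))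
    embed false true yv yw = free (there (here refl))
      (induced4 {G} (adj C4) (Graph.sym C4) (Graph.irr C4) path path-distinct (path-agrees yv yw))
    embed true false yv yw = free (there (there (here refl)))
      (induced4 {G} (adj Paw) (Graph.sym Paw) (Graph.irr Paw) fan fan-distinct (fan-agrees yv yw))
    embed true true yv yw = free (there (there (there (here refl))))
      (induced4 {G} (adj Diamond) (Graph.sym Diamond) (Graph.irr Diamond) fan fan-distinct (fan-agrees yv yw))

rank : ∀ {G} → Ordering G → Vertex G → ℕ
rank σ x = toℕ (pos σ x)

module _ {G : Graph} (quadFree : QuadFree G) where
  open Edges G

  common-neighbour : ∀ {S a v b} → WalkIn G S v b → E G a v → ¬ E G a b →
                     ∃[ x ] S x × E G a x × E G x b
  common-neighbour (here _) av a≁b = ⊥-elim (a≁b av)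
  common-neighbour {a = a} {v} {b} (step sv vv' rest) av a≁b with T? (adj G v b)
  ... | yes vb = v , sv , av , vb
  ... | no v≁b with common-neighbour rest vv' v≁b
  ...   | x , sx , vx , xb with T? (adj G a x)
  ...     | yes ax = x , sx , ax , xb
  ...     | no a≁x = ⊥-elim (quadFree record
              { yu = E-sym xb ; uv = E-sym vx ; vw = E-sym av ; u≁w = λ xa → a≁x (E-sym xa)
              ; u≢w = λ { refl → a≁b xb }
              ; y≢v = λ { refl → a≁b av }
              ; y≢w = λ { refl → v≁b (E-sym av) } })

  search⇒adjacent-to-middle : ∀ {σ} → IsSearchOrdering G σ → ∀ {a b c} →
                              a ≺[ σ ] b → b ≺[ σ ] c → E G a c → E G a b
  search⇒adjacent-to-middle {σ} search {a} {b} {c} a≺b b≺c ac =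
    decidable-stable (T? (adj G a b)) λ a≁b →
      no-middle-path a≁b (search b a b (ℕₚ.<-asym a≺b) (ℕₚ.<-irrefl refl))
    where
    no-middle-path : ¬ E G a b → ¬ WalkIn G (λ x → ¬ b ≺[ σ ] x) a b
    no-middle-path a≁b (here _) = ℕₚ.<-irrefl refl a≺b
    no-middle-path a≁b (step _ av rest) with common-neighbour rest av a≁b
    ... | x , x⊀b , ax , xb = quadFree {c} {a} {x} {b} record
      { yu = E-sym ac ; uv = ax ; vw = xb ; u≁w = a≁b
      ; u≢w = λ { refl → ℕₚ.<-irrefl refl a≺b }
      ; y≢v = λ { refl → x⊀b b≺c }
      ; y≢w = λ { refl → ℕₚ.<-irrefl refl b≺c } }

  quadFree⇒LexBFS : ∀ σ → IsSearchOrdering G σ → IsLexBFS G σ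
  quadFree⇒LexBFS σ search _ _ _ a≺b b≺c ac a≁b =
    ⊥-elim (a≁b (search⇒adjacent-to-middle {σ} search a≺b b≺c ac))

  quadFree⇒LexDFS : ∀ σ → IsSearchOrdering G σ → IsLexDFS G σ
  quadFree⇒LexDFS σ search _ _ _ a≺b b≺c ac a≁b =
    ⊥-elim (a≁b (search⇒adjacent-to-middle {σ} search a≺b b≺c ac))

HasEarlierNeighbours : (G : Graph) → Ordering G → Set
HasEarlierNeighbours G σ = ∀ x → 0 ℕ.< rank σ x → ∃[ y ] y ≺[ σ ] x × E G y x

module _ {G : Graph} {σ : Ordering G} (earlier : HasEarlierNeighbours G σ) where
  open Edges G

  private
    ⊀-trans : ∀ {x y z} → ¬ x ≺[ σ ] y → ¬ y ≺[ σ ] z → ¬ x ≺[ σ ] z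
    ⊀-trans x⊀y y⊀z x≺z = ℕₚ.<⇒≱ x≺z (ℕₚ.≤-trans (ℕₚ.≮⇒≥ y⊀z) (ℕₚ.≮⇒≥ x⊀y))

    walk-to-first : ∀ x → Acc ℕ._<_ (rank σ x) →
                    ∃[ r ] rank σ r ≡ 0 × WalkIn G (λ v → ¬ x ≺[ σ ] v) x r
    walk-to-first x (acc smaller) with rank σ x ℕ.≟ 0
    ... | yes x-first = x , x-first , here (ℕₚ.<-irrefl refl)
    ... | no x-later with earlier x (ℕₚ.n≢0⇒n>0 x-later)
    ...   | y , y≺x , yx with walk-to-first y (smaller y≺x)
    ...     | r , r-first , y→r =
              r , r-first , step (ℕₚ.<-irrefl refl) (E-sym yx) (mapʷ (⊀-trans (ℕₚ.<-asym y≺x)) y→r)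

  earlierNeighbours⇒search : IsSearchOrdering G σ
  earlierNeighbours⇒search k u v u⊀k v⊀k
    with walk-to-first u (<-wellFounded _) | walk-to-first v (<-wellFounded _)
  ... | r , r-first , u→r | r' , r'-first , v→r'
    with pos-inj σ (Finₚ.toℕ-injective (≡.trans r-first (≡.sym r'-first)))
  ... | refl = mapʷ (⊀-trans u⊀k) u→r ++ʷ reverseʷ (mapʷ (⊀-trans v⊀k) v→r')

_[_]≔_ : ∀ {A : Set} → (ℕ → A) → ℕ → A → ℕ → A
(f [ m ]≔ z) i with i ℕ.≟ m
... | yes _ = z
... | no _  = f i

[]≔-new : ∀ {A : Set} (f : ℕ → A) m z → (f [ m ]≔ z) m ≡ z
[]≔-new f m z with m ℕ.≟ m
... | yes _   = refl
... | no m≢m = ⊥-elim (m≢m refl)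

[]≔-old : ∀ {A : Set} (f : ℕ → A) {m i} z → i ℕ.< m → (f [ m ]≔ z) i ≡ f i
[]≔-old f {m} {i} z i<m with i ℕ.≟ m
... | yes refl = ⊥-elim (ℕₚ.<-irrefl refl i<m)
... | no _     = refl

-- Entries of `at` from index m on are junk.
record SearchSeq (G : Graph) (m : ℕ) : Set where
  field
    at           : ℕ → Vertex G
    at-injective : ∀ {i j} → i ℕ.< m → j ℕ.< m → at i ≡ at j → i ≡ j
    at-linked    : ∀ {i} → 0 ℕ.< i → i ℕ.< m → ∃[ j ] j ℕ.< i × E G (at j) (at i)

open SearchSeq

module _ {G : Graph} where
  open Edges G

  _∈ˢ_ : ∀ {m} → Vertex G → SearchSeq G m → Set
  _∈ˢ_ {m} x s = ∃[ i ] i ℕ.< m × at s i ≡ x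

  _∈ˢ?_ : ∀ {m} (x : Vertex G) (s : SearchSeq G m) → Dec (x ∈ˢ s)
  x ∈ˢ? s = ℕₚ.anyUpTo? (λ i → at s i Finₚ.≟ x) _

  Covers : ∀ {m} → SearchSeq G m → Set
  Covers s = ∀ x → x ∈ˢ s

  _⊑_ : ∀ {m m'} → SearchSeq G m → SearchSeq G m' → Set
  _⊑_ {m} s t = ∀ {i} → i ℕ.< m → at t i ≡ at s i

  length≤ : ∀ {m} → SearchSeq G m → m ℕ.≤ n G
  length≤ s = Finₚ.injective⇒≤ {f = λ i → at s (toℕ i)} λ {i} {j} eq →
    Finₚ.toℕ-injective (at-injective s (Finₚ.toℕ<n i) (Finₚ.toℕ<n j) eq)

  singleton : Vertex G → SearchSeq G 1
  singleton x = record
    { at = λ _ → x ; at-injective = λ { z<s z<s _ → refl } ; at-linked = λ { z<s (s<s ()) } }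

  ∉-singleton : ∀ {x z} → x ≢ z → ¬ z ∈ˢ singleton x
  ∉-singleton x≢z (_ , _ , x≡z) = x≢z x≡z

  module _ {m} (s : SearchSeq G m) (z : Vertex G) (z∉s : ¬ z ∈ˢ s) {y} (y∈s : y ∈ˢ s) (yz : E G y z) where

    push : SearchSeq G (suc m)
    push = record { at = at′ ; at-injective = injective ; at-linked = linked }
      where
      at′ : ℕ → Vertex G
      at′ = at s [ m ]≔ z
      old : ∀ {i} → i ℕ.< m → at′ i ≡ at s i
      old = []≔-old (at s) z
      new : at′ m ≡ z
      new = []≔-new (at s) m z
      injective : ∀ {i j} → i ℕ.< suc m → j ℕ.< suc m → at′ i ≡ at′ j → i ≡ j
      injective i<1+m j<1+m eq with ℕₚ.m<1+n⇒m<n∨m≡n i<1+m | ℕₚ.m<1+n⇒m<n∨m≡n j<1+m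
      ... | inj₁ i<m  | inj₁ j<m  = at-injective s i<m j<m (≡.trans (≡.sym (old i<m)) (≡.trans eq (old j<m)))
      ... | inj₁ i<m  | inj₂ refl = ⊥-elim (z∉s (_ , i<m , ≡.trans (≡.sym (old i<m)) (≡.trans eq new)))
      ... | inj₂ refl | inj₁ j<m  = ⊥-elim (z∉s (_ , j<m , ≡.trans (≡.sym (old j<m)) (≡.trans (≡.sym eq) new)))
      ... | inj₂ refl | inj₂ refl = refl
      linked : ∀ {i} → 0 ℕ.< i → i ℕ.< suc m → ∃[ j ] j ℕ.< i × E G (at′ j) (at′ i)
      linked 0<i i<1+m with ℕₚ.m<1+n⇒m<n∨m≡n i<1+m
      ... | inj₁ i<m with at-linked s 0<i i<m
      ...   | j , j<i , ji = j , j<i , subst₂ (E G) (≡.sym (old (ℕₚ.<-trans j<i i<m))) (≡.sym (old i<m)) ji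
      linked 0<i i<1+m | inj₂ refl =
        let k , k<m , sₖ≡y = y∈s
        in  k , k<m , subst₂ (E G) (≡.sym (≡.trans (old k<m) sₖ≡y)) (≡.sym new) yz

    push-extends : s ⊑ push
    push-extends = []≔-old (at s) z

BeginsWith : ∀ {G m} → Ordering G → SearchSeq G m → Set
BeginsWith {m = m} σ s = ∀ (i : Fin m) → rank σ (at s (toℕ i)) ≡ toℕ i

module _ {G : Graph} (connected : Connected G) where

  grow : ∀ {m} → 0 ℕ.< m → (s : SearchSeq G m) → Covers s ⊎ Σ (SearchSeq G (suc m)) (s ⊑_)
  grow 0<m s with Finₚ.all? (_∈ˢ? s)
  ... | yes covers = inj₁ covers
  ... | no ¬covers with Finₚ.¬∀⟶∃¬ _ (_∈ˢ s) (_∈ˢ? s) ¬covers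
  ...   | x , x∉s with walk-exits (_∈ˢ? s) (connected (at s 0) x tt tt) (0 , 0<m , refl) x∉s
  ...     | y , z , y∈s , z∉s , yz = inj₂ (push s z z∉s y∈s yz , push-extends s z z∉s y∈s yz)

  record Completion {m} (s : SearchSeq G m) : Set where
    field
      {length} : ℕ
      sequence : SearchSeq G length
      covers   : Covers sequence
      longer   : m ℕ.≤ length
      extends  : s ⊑ sequence

  complete : ∀ {m} → 0 ℕ.< m → (s : SearchSeq G m) → Completion s
  complete {m} 0<m s = go (n G ∸ m) (ℕₚ.m+[n∸m]≡n (length≤ s)) 0<m s
    where
    go : ∀ k {m} → m + k ≡ n G → 0 ℕ.< m → (s : SearchSeq G m) → Completion s
    go k {m} m+k≡n 0<m s with grow 0<m s | k
    ... | inj₁ covers | _ =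
      record { sequence = s ; covers = covers ; longer = ℕₚ.≤-refl ; extends = λ _ → refl }
    ... | inj₂ (t , _) | zero =
      ⊥-elim (ℕₚ.<-irrefl (≡.trans (≡.sym (ℕₚ.+-identityʳ m)) m+k≡n) (length≤ t))
    ... | inj₂ (t , s⊑t) | suc k =
      let c = go k (≡.trans (≡.sym (ℕₚ.+-suc m k)) m+k≡n) (ℕₚ.m<n⇒m<1+n 0<m) t
          open Completion c
      in record { sequence = sequence ; covers = covers ; longer = ℕₚ.≤-trans (ℕₚ.n≤1+n m) longer
                ; extends = λ i<m → ≡.trans (extends (ℕₚ.m<n⇒m<1+n i<m)) (s⊑t i<m) }

module _ {G : Graph} {m} (s : SearchSeq G m) (covers : Covers s) where

  private
    index : Vertex G → ℕ
    index x = proj₁ (covers x)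

    at-index : ∀ x → at s (index x) ≡ x
    at-index x = proj₂ (proj₂ (covers x))

    index<n : ∀ x → index x ℕ.< n G
    index<n x = ℕₚ.<-≤-trans (proj₁ (proj₂ (covers x))) (length≤ s)

    index-at : ∀ {i} → i ℕ.< m → index (at s i) ≡ i
    index-at i<m = at-injective s (proj₁ (proj₂ (covers _))) i<m (at-index _)

  seqOrdering : Ordering G
  seqOrdering = record { pos = λ x → fromℕ< (index<n x) ; pos-inj = injective }
    where
    injective : ∀ {x y} → fromℕ< (index<n x) ≡ fromℕ< (index<n y) → x ≡ y
    injective {x} {y} eq = begin
      x                ≡⟨ ≡.sym (at-index x) ⟩
      at s (index x)   ≡⟨ cong (at s) index-eq ⟩
      at s (index y)   ≡⟨ at-index y ⟩
      y                ∎
      where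
      open ≡.≡-Reasoning
      index-eq : index x ≡ index y
      index-eq = ≡.trans (≡.sym (Finₚ.toℕ-fromℕ< (index<n x)))
                   (≡.trans (cong toℕ eq) (Finₚ.toℕ-fromℕ< (index<n y)))

  private
    rank≡index : ∀ x → rank seqOrdering x ≡ index x
    rank≡index x = Finₚ.toℕ-fromℕ< (index<n x)

  rank-seqOrdering : ∀ {i} → i ℕ.< m → rank seqOrdering (at s i) ≡ i
  rank-seqOrdering i<m = ≡.trans (rank≡index _) (index-at i<m)

  seqOrdering-earlierNeighbours : HasEarlierNeighbours G seqOrdering
  seqOrdering-earlierNeighbours x 0<rank
    with at-linked s (≡.subst (0 ℕ.<_) (rank≡index x) 0<rank) (proj₁ (proj₂ (covers x)))
  ... | j , j<index , jx = at s j , j≺x , ≡.subst (E G (at s j)) (at-index x) jx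
    where
    j≺x : at s j ≺[ seqOrdering ] x
    j≺x = subst₂ ℕ._<_ (≡.sym (rank-seqOrdering (ℕₚ.<-trans j<index (proj₁ (proj₂ (covers x))))))
                        (≡.sym (rank≡index x)) j<index

searchOrdering-extending : ∀ {G m} → Connected G → 0 ℕ.< m → (s : SearchSeq G m) →
                           ∃[ σ ] IsSearchOrdering G σ × BeginsWith σ s
searchOrdering-extending {G} connected 0<m s = σ , earlierNeighbours⇒search {σ = σ} earlier , begins
  where
  open Completion (complete connected 0<m s)
  σ : Ordering G
  σ = seqOrdering sequence covers
  earlier : HasEarlierNeighbours G σ
  earlier = seqOrdering-earlierNeighbours sequence covers
  begins : BeginsWith σ s
  begins i = ≡.trans (cong (rank σ) (≡.sym (extends (Finₚ.toℕ<n i))))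
                     (rank-seqOrdering sequence covers (ℕₚ.<-≤-trans (Finₚ.toℕ<n i) longer))

module _ {G : Graph} {σ : Ordering G} {a b c : Vertex G}
         (ac : E G a c) (a≁b : ¬ E G a b) (b≺c : b ≺[ σ ] c) where

  first-violates-LexBFS : rank σ a ≡ 0 → a ≺[ σ ] b → ¬ IsLexBFS G σ
  first-violates-LexBFS a-first a≺b lexBFS with lexBFS a b c a≺b b≺c ac a≁b
  ... | d , d≺a , _ = ℕₚ.n≮0 (subst (rank σ d ℕ.<_) a-first d≺a)

  successor-violates-LexDFS : rank σ b ≡ suc (rank σ a) → ¬ IsLexDFS G σ
  successor-violates-LexDFS b-next lexDFS
    with lexDFS a b c (ℕₚ.≤-reflexive (≡.sym b-next)) b≺c ac a≁b
  ... | d , a≺d , d≺b , _ = ℕₚ.<⇒≱ a≺d (ℕ.s≤s⁻¹ (subst (suc (rank σ d) ℕ.≤_) b-next d≺b))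

module _ {G : Graph} (connected : Connected G) {y u v w} (q : Quad G y u v w) where
  open Edges G
  open Quad q

  private
    rank-order : ∀ (σ : Ordering G) {x x' i j} →
                 rank σ x ≡ i → rank σ x' ≡ j → i ℕ.< j → x ≺[ σ ] x'
    rank-order _ refl refl i<j = i<j

    seq-uvwy : SearchSeq G 4
    seq-uvwy = push s₃ y y∉s₃ (0 , z<s , refl) (E-sym yu)
      where
      s₂ : SearchSeq G 2
      s₂ = push (singleton u) v (∉-singleton {G = G} (E⇒≢ uv)) (0 , z<s , refl) uv
      w∉s₂ : ¬ w ∈ˢ s₂
      w∉s₂ (0 , _ , u≡w) = u≢w u≡w
      w∉s₂ (1 , _ , v≡w) = E⇒≢ vw v≡w
      w∉s₂ (suc (suc _) , s<s (s<s ()) , _)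
      s₃ : SearchSeq G 3
      s₃ = push s₂ w w∉s₂ (1 , s<s z<s , refl) vw
      y∉s₃ : ¬ y ∈ˢ s₃
      y∉s₃ (0 , _ , u≡y) = E⇒≢ yu (≡.sym u≡y)
      y∉s₃ (1 , _ , v≡y) = y≢v (≡.sym v≡y)
      y∉s₃ (2 , _ , w≡y) = y≢w (≡.sym w≡y)
      y∉s₃ (suc (suc (suc _)) , s<s (s<s (s<s ())) , _)

    seq-vuwy : SearchSeq G 4
    seq-vuwy = push s₃ y y∉s₃ (1 , s<s z<s , refl) (E-sym yu)
      where
      s₂ : SearchSeq G 2
      s₂ = push (singleton v) u (∉-singleton {G = G} (≢-sym (E⇒≢ uv))) (0 , z<s , refl) (E-sym uv)
      w∉s₂ : ¬ w ∈ˢ s₂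
      w∉s₂ (0 , _ , v≡w) = E⇒≢ vw v≡w
      w∉s₂ (1 , _ , u≡w) = u≢w u≡w
      w∉s₂ (suc (suc _) , s<s (s<s ()) , _)
      s₃ : SearchSeq G 3
      s₃ = push s₂ w w∉s₂ (0 , z<s , refl) vw
      y∉s₃ : ¬ y ∈ˢ s₃
      y∉s₃ (0 , _ , v≡y) = y≢v (≡.sym v≡y)
      y∉s₃ (1 , _ , u≡y) = E⇒≢ yu (≡.sym u≡y)
      y∉s₃ (2 , _ , w≡y) = y≢w (≡.sym w≡y)
      y∉s₃ (suc (suc (suc _)) , s<s (s<s (s<s ())) , _)

  quad⇒¬LexBFS : ¬ (∀ σ → IsSearchOrdering G σ → IsLexBFS G σ)
  quad⇒¬LexBFS lexBFS = violated (searchOrdering-extending connected z<s seq-uvwy)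
    where
    violated : ¬ (∃[ σ ] IsSearchOrdering G σ × BeginsWith σ seq-uvwy)
    violated (σ , search , begins) =
      first-violates-LexBFS {σ = σ} (E-sym yu) u≁w (rank-order σ (begins 2F) (begins 3F) (ℕₚ.n<1+n 2))
        (begins 0F) (rank-order σ (begins 0F) (begins 2F) z<s) (lexBFS σ search)

  quad⇒¬LexDFS : ¬ (∀ σ → IsSearchOrdering G σ → IsLexDFS G σ)
  quad⇒¬LexDFS lexDFS = violated (searchOrdering-extending connected z<s seq-vuwy)
    where
    violated : ¬ (∃[ σ ] IsSearchOrdering G σ × BeginsWith σ seq-vuwy)
    violated (σ , search , begins) =
      successor-violates-LexDFS {σ = σ} (E-sym yu) u≁w (rank-order σ (begins 2F) (begins 3F) (ℕₚ.n<1+n 2))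
        (≡.trans (begins 2F) (cong suc (≡.sym (begins 1F)))) (lexDFS σ search)

corollary1 : (G : Graph) → Connected G →
    (P4C4PawDiamondFree G ⇔ (∀ σ → IsSearchOrdering G σ → IsLexDFS G σ))
    × (P4C4PawDiamondFree G ⇔ (∀ σ → IsSearchOrdering G σ → IsLexBFS G σ))
corollary1 G connected =
  mk⇔ (λ (free : P4C4PawDiamondFree G) → quadFree⇒LexDFS (free⇒quadFree {G} free))
      (λ lexDFS → quadFree⇒free λ quad → quad⇒¬LexDFS connected quad lexDFS) ,
  mk⇔ (λ (free : P4C4PawDiamondFree G) → quadFree⇒LexBFS (free⇒quadFree {G} free))
      (λ lexBFS → quadFree⇒free λ quad → quad⇒¬LexBFS connected quad lexBFS)
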